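{- Let $\mu$ be a nonempty partition and let $i_d$ be the largest integer $i$ with $\mu_i\ge d(\mu)$. Then \[ \mu^c_i=\begin{cases}\mu_i-1 & \text{if } i\le i_d,\\ d(\mu)-1 & \text{if } i=i_d+1,\\ \mu_{i-1} & \text{if } i>i_d+1.\end{cases} \]
   Context: For a partition $\lambda$ set $\lambda_t=0$ for $t>\ell(\lambda)$; $d(\lambda)$ is the largest $i\ge1$ with $\lambda_i\ge i$ (length of the diagonal). The Maya diagram of $\lambda$ is $S(\lambda)=\{\lambda_t-t+\tfrac12:t\ge1\}$. For $S\subseteq\mathbb{Z}+\tfrac12$ let $S^+=\{x\in S:x>0\}$, $S^-=\{x\in(\mathbb{Z}+\tfrac12)\setminus S:x<0\}$; if finite, $c(S)=|S^+|-|S^-|$ and $\{s-c(S):s\in S\}$ is the Maya diagram of a unique partition, the partition associated to $S$. For nonempty $\mu$ with $S=S(\mu)$, $\mu^c$ is the partition associated to $S\cup\{\max S^-\}$ (charge $1$). -}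

module Defs where

open import Data.Nat using (ℕ; zero; suc; _≥_; _≤_; _<_; _∸_)
open import Data.Integer as ℤ using (ℤ; +_; _-_; _+_)
open import Data.List using (List; []; _∷_; length)
open import Data.List.Relation.Unary.All using (All)
open import Data.List.Relation.Unary.Linked using (Linked)
open import Data.List.Relation.Unary.Unique.Propositional using (Unique)
open import Data.List.Membership.Propositional using (_∈_)
open import Data.Product using (Σ; ∃; _×_)
open import Data.Sum using (_⊎_)
open import Relation.Nullary using (¬_)
open import Relation.Binary.PropositionalEquality using (_≡_; _≢_)
open import Function.Bundles using (_⇔_)

record Partition : Set where
  field
    parts    : List ℕ
    decr     : Linked _≥_ parts
    positive : All (λ x → 1 ≤ x) parts
open Partition public

-- 1-indexed entries, with λ_t = 0 for t > ℓ(λ).  (Index 0 is unused.)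
entry : List ℕ → ℕ → ℕ
entry []       _             = 0
entry (x ∷ xs) zero          = 0
entry (x ∷ xs) (suc zero)    = x
entry (x ∷ xs) (suc (suc n)) = entry xs (suc n)

_⟦_⟧ : Partition → ℕ → ℕ
λp ⟦ t ⟧ = entry (parts λp) t

Nonempty : Partition → Set
Nonempty λp = parts λp ≢ []

IsDiagLength : Partition → ℕ → Set
IsDiagLength λp d = 1 ≤ d × λp ⟦ d ⟧ ≥ d × (∀ i → 1 ≤ i → λp ⟦ i ⟧ ≥ i → i ≤ d)

IsLargestIndexAtLeast : Partition → ℕ → ℕ → Set
IsLargestIndexAtLeast λp d j =
  1 ≤ j × λp ⟦ j ⟧ ≥ d × (∀ i → 1 ≤ i → λp ⟦ i ⟧ ≥ d → i ≤ j)

-- Subsets of ℤ + 1/2 are encoded as predicates on ℤ: k ∈ ℤ stands for k + 1/2.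
-- Under this encoding x > 0 iff k ≥ 0 and x < 0 iff k < 0, and shifting by
-- an integer c is shifting k by c.
HalfSet : Set₁
HalfSet = ℤ → Set

Maya : Partition → HalfSet
Maya λp k = Σ ℕ λ t → 1 ≤ t × k ≡ (+ (λp ⟦ t ⟧)) - (+ t)

HasCharge : HalfSet → ℤ → Set
HasCharge S c =
  Σ (List ℤ) λ Lp → Σ (List ℤ) λ Ln →
    Unique Lp × (∀ k → (k ∈ Lp) ⇔ (S k × (+ 0) ℤ.≤ k)) ×
    Unique Ln × (∀ k → (k ∈ Ln) ⇔ (¬ S k × k ℤ.< (+ 0))) ×
    c ≡ (+ length Lp) - (+ length Ln)

IsAssociated : HalfSet → Partition → Set
IsAssociated S ν = Σ ℤ λ c → HasCharge S c × (∀ k → Maya ν k ⇔ S (k + c))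

IsMaxHole : HalfSet → ℤ → Set
IsMaxHole S m = m ℤ.< (+ 0) × ¬ S m × (∀ k → k ℤ.< (+ 0) → ¬ S k → k ℤ.≤ m)

insert : HalfSet → ℤ → HalfSet
insert S m k = S k ⊎ k ≡ m

IsMuC : Partition → Partition → Set
IsMuC μ ν = Σ ℤ λ m → IsMaxHole (Maya μ) m × IsAssociated (insert (Maya μ) m) ν

-- The largest hole of S(μ) sits at d − (i_d + 1): the rows i ≤ i_d are at least d,
-- rows beyond i_d are below d, and the rows d < t ≤ i_d equal d and fill every
-- position between that hole and 0.  Adding it to S(μ) gives exactly the Maya diagram
-- of the sequence obtained from μ by inserting a row of length d after row i_d and
-- lengthening every later row by one.  A decreasing sequence is determined by its
-- Maya diagram, so the rows of μ^c are the rows of that sequence shifted by the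
-- charge, and the charge is forced to be 1 because the sequence ends in 1s while
-- μ^c ends in 0s.
module Submission where

open import Defs
open import Data.Nat using (ℕ; suc; _≤_; _<_; _∸_)
open import Relation.Binary.PropositionalEquality using (_≡_)
open import Data.Product using (_×_)

open import Data.Nat using (zero; z≤n; s≤s; _+_; _≥_)
import Data.Nat.Properties as ℕP
open import Data.Nat.Induction using (<-rec)
open import Data.Integer as ℤ using (ℤ; +_; -[1+_]; _-_; +<+)
import Data.Integer.Properties as ℤP
open import Data.Integer.Tactic.RingSolver using (solve-∀)
open import Data.List using ([]; _∷_; length)
open import Data.List.Relation.Unary.Linked using (Linked; []; [-]; _∷_)
open import Data.Product using (Σ; ∃-syntax; _,_; proj₁; proj₂)
open import Data.Sum using (inj₁; inj₂)
open import Function.Bundles using (_⇔_; mk⇔; Equivalence)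
import Function.Properties.Equivalence as ⇔
open import Relation.Binary.Definitions using (tri<; tri≈; tri>)
open import Relation.Binary.PropositionalEquality
  using (refl; sym; trans; cong; subst; subst₂; module ≡-Reasoning)
open import Relation.Nullary using (¬_; yes; no; contradiction)

private
  diff-+-pos : ∀ m n p → + m - + n ℤ.+ + (n + p) ≡ + (m + p)
  diff-+-pos m n p = begin
    + m - + n ℤ.+ + (n + p)      ≡⟨ cong (λ x → + m - + n ℤ.+ x) (ℤP.pos-+ n p) ⟩
    + m - + n ℤ.+ (+ n ℤ.+ + p)  ≡⟨ cancel (+ m) (+ n) (+ p) ⟩
    + m ℤ.+ + p                  ≡⟨ ℤP.pos-+ m p ⟨
    + (m + p)                    ∎
    where
    open ≡-Reasoning
    cancel : ∀ x y z → x - y ℤ.+ (y ℤ.+ z) ≡ x ℤ.+ z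
    cancel = solve-∀

  diff-+-pos′ : ∀ o p n → + o - + p ℤ.+ + (n + p) ≡ + (o + n)
  diff-+-pos′ o p n = trans (cong (λ s → + o - + p ℤ.+ + s) (ℕP.+-comm n p)) (diff-+-pos o p n)

m-n≡o-p⇒m+p≡o+n : ∀ m n o p → + m - + n ≡ + o - + p → m + p ≡ o + n
m-n≡o-p⇒m+p≡o+n m n o p eq = ℤP.+-injective (begin
  + (m + p)                ≡⟨ diff-+-pos m n p ⟨
  + m - + n ℤ.+ + (n + p)  ≡⟨ cong (ℤ._+ + (n + p)) eq ⟩
  + o - + p ℤ.+ + (n + p)  ≡⟨ diff-+-pos′ o p n ⟩
  + (o + n)                ∎)
  where open ≡-Reasoning

m-n<o-p⇒m+p<o+n : ∀ m n o p → + m - + n ℤ.< + o - + p → m + p < o + n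
m-n<o-p⇒m+p<o+n m n o p lt =
  ℤP.drop‿+<+ (subst₂ ℤ._<_ (diff-+-pos m n p) (diff-+-pos′ o p n) (ℤP.+-monoˡ-< (+ (n + p)) lt))

m+p≡o+n⇒m-n≡o-p : ∀ m n o p → m + p ≡ o + n → + m - + n ≡ + o - + p
m+p≡o+n⇒m-n≡o-p m n o p eq with ℤP.<-cmp (+ m - + n) (+ o - + p)
... | tri< lt _ _ = contradiction eq (ℕP.<⇒≢ (m-n<o-p⇒m+p<o+n m n o p lt))
... | tri≈ _ e _  = e
... | tri> _ _ gt = contradiction (sym eq) (ℕP.<⇒≢ (m-n<o-p⇒m+p<o+n o p m n gt))

m+p<o+n⇒m-n<o-p : ∀ m n o p → m + p < o + n → + m - + n ℤ.< + o - + p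
m+p<o+n⇒m-n<o-p m n o p lt with ℤP.<-cmp (+ m - + n) (+ o - + p)
... | tri< l _ _ = l
... | tri≈ _ e _ = contradiction (m-n≡o-p⇒m+p≡o+n m n o p e) (ℕP.<⇒≢ lt)
... | tri> _ _ g = contradiction lt (ℕP.<-asym (m-n<o-p⇒m+p<o+n o p m n g))

[1+m]-[1+n]≡m-n : ∀ m n → + suc m - + suc n ≡ + m - + n
[1+m]-[1+n]≡m-n m n = m+p≡o+n⇒m-n≡o-p (suc m) (suc n) m n (sym (ℕP.+-suc m n))

m≡n-1⇒m≡n∸1 : ∀ m n → + m ≡ + n - + 1 → m ≡ n ∸ 1
m≡n-1⇒m≡n∸1 m n eq = trans (sym (ℕP.m+n∸n≡m m 1)) (cong (_∸ 1) (trans m+1≡n+0 (ℕP.+-identityʳ n)))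
  where
  m+1≡n+0 : m + 1 ≡ n + 0
  m+1≡n+0 = m-n≡o-p⇒m+p≡o+n m 0 n 1 (trans (ℤP.+-identityʳ (+ m)) eq)

StrictlyDecreasing : (ℕ → ℤ) → Set
StrictlyDecreasing f = ∀ t → f (suc t) ℤ.< f t

ImageIncluded : (ℕ → ℤ) → (ℕ → ℤ) → Set
ImageIncluded f g = ∀ t → ∃[ s ] f t ≡ g s

strictlyDecreasing-< : ∀ {f} → StrictlyDecreasing f → ∀ {s t} → s < t → f t ℤ.< f s
strictlyDecreasing-< f↓ {s} {suc t} (s≤s s≤t) with ℕP.m≤n⇒m<n∨m≡n s≤t
... | inj₁ s<t  = ℤP.<-trans (f↓ t) (strictlyDecreasing-< f↓ s<t)
... | inj₂ refl = f↓ t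

private
  image-≤ : ∀ {f g} → StrictlyDecreasing f → StrictlyDecreasing g → ImageIncluded f g →
            ∀ t → (∀ {s} → s < t → f s ≡ g s) → f t ℤ.≤ g t
  image-≤ f↓ g↓ f⊆g t agree with f⊆g t
  ... | s , ft≡gs with ℕP.<-cmp s t
  ... | tri< s<t _ _ = contradiction (trans ft≡gs (sym (agree s<t))) (ℤP.<⇒≢ (strictlyDecreasing-< f↓ s<t))
  ... | tri≈ _ refl _ = ℤP.≤-reflexive ft≡gs
  ... | tri> _ _ t<s = ℤP.≤-trans (ℤP.≤-reflexive ft≡gs) (ℤP.<⇒≤ (strictlyDecreasing-< g↓ t<s))

strictlyDecreasing-image-unique : ∀ {f g} → StrictlyDecreasing f → StrictlyDecreasing g →
                                  ImageIncluded f g → ImageIncluded g f → ∀ t → f t ≡ g t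
strictlyDecreasing-image-unique f↓ g↓ f⊆g g⊆f = <-rec _ λ t agree →
  ℤP.≤-antisym (image-≤ f↓ g↓ f⊆g t agree) (image-≤ g↓ f↓ g⊆f t (λ s<t → sym (agree s<t)))

-- Sequences ℕ → ℕ are indexed from 1, like the rows of a partition; index 0 is ignored.
Decreasing : (ℕ → ℕ) → Set
Decreasing a = ∀ n → a (suc (suc n)) ≤ a (suc n)

decreasing-antitone : ∀ {a} → Decreasing a → ∀ {i j} → 1 ≤ i → i ≤ j → a j ≤ a i
decreasing-antitone {a} a↓ {suc i} {j} _ i+1≤j =
  subst (λ n → a n ≤ a (suc i)) (trans (sym (ℕP.+-suc (j ∸ suc i) i)) (ℕP.m∸n+n≡m i+1≤j)) (steps (j ∸ suc i))
  where
  steps : ∀ k → a (suc (k + i)) ≤ a (suc i)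
  steps zero    = ℕP.≤-refl
  steps (suc k) = ℕP.≤-trans (a↓ (k + i)) (steps k)

entry-decreasing : ∀ {xs} → Linked _≥_ xs → Decreasing (entry xs)
entry-decreasing []        _       = z≤n
entry-decreasing [-]       _       = z≤n
entry-decreasing (x≥y ∷ _) zero    = x≥y
entry-decreasing (_ ∷ xs↓) (suc n) = entry-decreasing xs↓ n

entry-beyond-length : ∀ xs {n} → length xs < n → entry xs n ≡ 0
entry-beyond-length []       _ = refl
entry-beyond-length (x ∷ xs) {suc (suc n)} (s≤s l<n) = entry-beyond-length xs l<n

SeqMaya : (ℕ → ℕ) → HalfSet
SeqMaya a k = Σ ℕ λ t → 1 ≤ t × k ≡ + a t - + t

seqMaya-strictlyDecreasing : ∀ {a} → Decreasing a → StrictlyDecreasing (λ t → + a (suc t) - + suc t)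
seqMaya-strictlyDecreasing {a} a↓ t =
  m+p<o+n⇒m-n<o-p (a (suc (suc t))) (suc (suc t)) (a (suc t)) (suc t) (ℕP.+-mono-≤-< (a↓ t) (ℕP.n<1+n (suc t)))

seqMaya-translate⇒rows : ∀ {a b c} → Decreasing a → Decreasing b →
                         (∀ k → SeqMaya a k ⇔ SeqMaya b (k ℤ.+ c)) → ∀ t → 1 ≤ t → + a t ≡ + b t - c
seqMaya-translate⇒rows {a} {b} {c} a↓ b↓ a≈b (suc t) _ = solve-row (f≡g t)
  where
  add-sub : ∀ x y → x ≡ x ℤ.+ y - y
  add-sub = solve-∀
  sub-add : ∀ x y → x - y ℤ.+ y ≡ x
  sub-add = solve-∀
  sub-sub-add : ∀ x y z → x - y - z ℤ.+ y ≡ x - z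
  sub-sub-add = solve-∀

  f g : ℕ → ℤ
  f t = + a (suc t) - + suc t
  g t = + b (suc t) - + suc t - c

  f⊆g : ImageIncluded f g
  f⊆g t with Equivalence.to (a≈b (f t)) (suc t , s≤s z≤n , refl)
  ... | suc s , _ , e = s , trans (add-sub (f t) c) (cong (_- c) e)

  g⊆f : ImageIncluded g f
  g⊆f t with Equivalence.from (a≈b (g t)) (suc t , s≤s z≤n , sub-add (+ b (suc t) - + suc t) c)
  ... | suc s , _ , e = s , e

  f≡g : ∀ t → f t ≡ g t
  f≡g = strictlyDecreasing-image-unique (seqMaya-strictlyDecreasing {a} a↓)
          (λ t → ℤP.+-monoˡ-< (ℤ.- c) (seqMaya-strictlyDecreasing {b} b↓ t)) f⊆g g⊆f

  solve-row : f t ≡ g t → + a (suc t) ≡ + b (suc t) - c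
  solve-row e = trans (sym (sub-add (+ a (suc t)) (+ suc t)))
                      (trans (cong (ℤ._+ + suc t) e) (sub-sub-add (+ b (suc t)) (+ suc t) c))


-- (a₁, …, a_q, r, a_{q+1} + 1, a_{q+2} + 1, …): moving a row one index down lowers its
-- Maya coordinate by one, which the + 1 compensates.
insertRow : ℕ → ℕ → (ℕ → ℕ) → ℕ → ℕ
insertRow q r a n with ℕP.<-cmp n (suc q)
... | tri< _ _ _ = a n
... | tri≈ _ _ _ = r
... | tri> _ _ _ = suc (a (n ∸ 1))

module _ (q r : ℕ) (a : ℕ → ℕ) where

  insertRow-< : ∀ {n} → n < suc q → insertRow q r a n ≡ a n
  insertRow-< {n} n<q+1 with ℕP.<-cmp n (suc q)
  ... | tri< _ _ _    = refl
  ... | tri≈ n≮q+1 _ _ = contradiction n<q+1 n≮q+1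
  ... | tri> n≮q+1 _ _ = contradiction n<q+1 n≮q+1

  insertRow-≡ : insertRow q r a (suc q) ≡ r
  insertRow-≡ with ℕP.<-cmp (suc q) (suc q)
  ... | tri< _ q+1≢q+1 _ = contradiction refl q+1≢q+1
  ... | tri≈ _ _ _       = refl
  ... | tri> _ q+1≢q+1 _ = contradiction refl q+1≢q+1

  insertRow-> : ∀ {n} → suc q < n → insertRow q r a n ≡ suc (a (n ∸ 1))
  insertRow-> {n} q+1<n with ℕP.<-cmp n (suc q)
  ... | tri< _ _ q+1≮n = contradiction q+1<n q+1≮n
  ... | tri≈ _ _ q+1≮n = contradiction q+1<n q+1≮n
  ... | tri> _ _ _     = refl

  insertRow-decreasing : Decreasing a → r ≤ a q → a (suc q) < r → Decreasing (insertRow q r a)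
  insertRow-decreasing a↓ r≤aq aq+1<r n with ℕP.<-cmp (suc n) (suc q)
  ... | tri< n+1<q+1 _ _ with ℕP.m≤n⇒m<n∨m≡n n+1<q+1
  ...   | inj₁ n+2<q+1 rewrite insertRow-< n+2<q+1 = a↓ n
  ...   | inj₂ refl    rewrite insertRow-≡ = r≤aq
  insertRow-decreasing a↓ r≤aq aq+1<r n | tri≈ _ refl _
    rewrite insertRow-> (ℕP.n<1+n (suc q)) = aq+1<r
  insertRow-decreasing a↓ r≤aq aq+1<r n | tri> _ _ q+1<n+1
    rewrite insertRow-> (ℕP.<-trans q+1<n+1 (ℕP.n<1+n (suc n))) =
    s≤s (decreasing-antitone {a} a↓ (ℕP.≤-trans (s≤s z≤n) (ℕP.≤-pred q+1<n+1)) (ℕP.n≤1+n n))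

  insertRow-seqMaya : ∀ k → SeqMaya (insertRow q r a) k ⇔ insert (SeqMaya a) (+ r - + suc q) k
  insertRow-seqMaya k = mk⇔ to from
    where
    to : SeqMaya (insertRow q r a) k → insert (SeqMaya a) (+ r - + suc q) k
    to (suc t , 1≤t+1 , refl) with ℕP.<-cmp (suc t) (suc q)
    ... | tri< t+1<q+1 _ _ = inj₁ (suc t , 1≤t+1 , refl)
    ... | tri≈ _ refl _    = inj₂ refl
    ... | tri> _ _ q+1<t+1 = inj₁ (t , ℕP.≤-trans (s≤s z≤n) (ℕP.≤-pred q+1<t+1) ,
                                   [1+m]-[1+n]≡m-n (a t) t)

    from : insert (SeqMaya a) (+ r - + suc q) k → SeqMaya (insertRow q r a) k
    from (inj₁ (t , 1≤t , refl)) with t ℕP.<? suc q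
    ... | yes t<q+1 = t , 1≤t , cong (λ x → + x - + t) (sym (insertRow-< t<q+1))
    ... | no  t≮q+1 = suc t , s≤s z≤n ,
                      trans (sym ([1+m]-[1+n]≡m-n (a t) t))
                            (cong (λ x → + x - + suc t) (sym (insertRow-> (s≤s (ℕP.≮⇒≥ t≮q+1)))))
    from (inj₂ refl) = suc q , s≤s z≤n , cong (λ x → + x - + suc q) (sym insertRow-≡)

-- Far out a partition has rows 0 while insertRow q r (entry xs) has rows 1.
rows≡insertRow-c⇒c≡1 : ∀ (ν : Partition) q r xs {c} →
                       (∀ t → 1 ≤ t → + ν ⟦ t ⟧ ≡ + insertRow q r (entry xs) t - c) → c ≡ + 1
rows≡insertRow-c⇒c≡1 ν q r xs {c} rows≡ = trans (ring c) (cong (+ 1 -_) (sym far-out))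
  where
  ring : ∀ c → c ≡ + 1 - (+ 1 - c)
  ring = solve-∀
  lxs lν N : ℕ
  lxs = length xs
  lν  = length (parts ν)
  N   = suc (suc (q + (lxs + lν)))
  ν-far : ν ⟦ N ⟧ ≡ 0
  ν-far = entry-beyond-length (parts ν)
            (s≤s (ℕP.m≤n⇒m≤1+n (ℕP.≤-trans (ℕP.m≤n+m lν lxs) (ℕP.m≤n+m (lxs + lν) q))))
  insertRow-far : insertRow q r (entry xs) N ≡ 1
  insertRow-far = trans (insertRow-> q r (entry xs) (s≤s (s≤s (ℕP.m≤m+n q _))))
                    (cong suc (entry-beyond-length xs (s≤s (ℕP.≤-trans (ℕP.m≤m+n lxs lν) (ℕP.m≤n+m (lxs + lν) q)))))
  far-out : + 0 ≡ + 1 - c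
  far-out = trans (cong +_ (sym ν-far)) (trans (rows≡ N (s≤s z≤n)) (cong (λ x → + x - c) insertRow-far))

maxHole-unique : ∀ {S m m′} → IsMaxHole S m → IsMaxHole S m′ → m ≡ m′
maxHole-unique (m<0 , m∉S , m-max) (m′<0 , m′∉S , m′-max) =
  ℤP.≤-antisym (m′-max _ m<0 m∉S) (m-max _ m′<0 m′∉S)

module _ (μ : Partition) {d iₐ : ℕ} (dg : IsDiagLength μ d) (li : IsLargestIndexAtLeast μ d iₐ) where

  private
    μ↓ : Decreasing (μ ⟦_⟧)
    μ↓ = entry-decreasing (decr μ)

  d≤iₐ : d ≤ iₐ
  d≤iₐ = proj₂ (proj₂ li) d (proj₁ dg) (proj₁ (proj₂ dg))

  d≤row : ∀ {t} → 1 ≤ t → t ≤ iₐ → d ≤ μ ⟦ t ⟧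
  d≤row 1≤t t≤iₐ = ℕP.≤-trans (proj₁ (proj₂ li)) (decreasing-antitone {μ ⟦_⟧} μ↓ 1≤t t≤iₐ)

  row<d : ∀ {t} → iₐ < t → μ ⟦ t ⟧ < d
  row<d iₐ<t = ℕP.≤-<-trans (decreasing-antitone {μ ⟦_⟧} μ↓ (s≤s z≤n) iₐ<t)
                 (ℕP.≰⇒> (λ d≤row → ℕP.1+n≰n (proj₂ (proj₂ li) (suc iₐ) (s≤s z≤n) d≤row)))

  row≤d : ∀ {t} → d < t → μ ⟦ t ⟧ ≤ d
  row≤d d<t = ℕP.≤-trans (decreasing-antitone {μ ⟦_⟧} μ↓ (s≤s z≤n) d<t)
                (ℕP.≮⇒≥ (λ d<row → ℕP.1+n≰n (proj₂ (proj₂ dg) (suc d) (s≤s z≤n) d<row)))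

  diagonalHole : IsMaxHole (Maya μ) (+ d - + suc iₐ)
  diagonalHole = hole<0 , hole∉ , hole-max
    where
    hole<0 : + d - + suc iₐ ℤ.< + 0
    hole<0 = m+p<o+n⇒m-n<o-p d (suc iₐ) 0 0 (subst (_< suc iₐ) (sym (ℕP.+-identityʳ d)) (s≤s d≤iₐ))

    hole∉ : ¬ Maya μ (+ d - + suc iₐ)
    hole∉ (t , 1≤t , e) with m-n≡o-p⇒m+p≡o+n d (suc iₐ) (μ ⟦ t ⟧) t e | t ℕP.≤? iₐ
    ... | eq | yes t≤iₐ = ℕP.<⇒≢ (ℕP.+-mono-≤-< (d≤row 1≤t t≤iₐ) (s≤s t≤iₐ)) eq
    ... | eq | no  t≰iₐ = ℕP.<⇒≢ (ℕP.+-mono-<-≤ (row<d (ℕP.≰⇒> t≰iₐ)) (ℕP.≰⇒> t≰iₐ)) (sym eq)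

    -- The rows d < t ≤ iₐ all have length d, so they fill every position above the hole.
    above-hole : ∀ {k} → k ℤ.< + 0 → + d - + suc iₐ ℤ.< k → Maya μ k
    above-hole {+ _}      (+<+ ()) _
    above-hole { -[1+ j ]} _ hole<k =
      t , ℕP.≤-trans (proj₁ dg) (ℕP.m≤m+n d (suc j)) ,
      m+p≡o+n⇒m-n≡o-p 0 (suc j) (μ ⟦ t ⟧) t (cong (_+ suc j) (sym row≡d))
      where
      t : ℕ
      t = d + suc j
      row≡d : μ ⟦ t ⟧ ≡ d
      row≡d = ℕP.≤-antisym (row≤d (ℕP.m<m+n d (s≤s z≤n)))
                (d≤row (ℕP.≤-trans (proj₁ dg) (ℕP.m≤m+n d (suc j)))
                       (ℕP.≤-pred (m-n<o-p⇒m+p<o+n d (suc iₐ) 0 (suc j) hole<k)))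

    hole-max : ∀ k → k ℤ.< + 0 → ¬ Maya μ k → k ℤ.≤ + d - + suc iₐ
    hole-max k k<0 k∉ = ℤP.≮⇒≥ (λ hole<k → k∉ (above-hole k<0 hole<k))

lemma5p17 : (μ ν : Partition) → Nonempty μ → IsMuC μ ν →
    (d iₐ : ℕ) → IsDiagLength μ d → IsLargestIndexAtLeast μ d iₐ →
    (∀ i → 1 ≤ i → i ≤ iₐ → ν ⟦ i ⟧ ≡ μ ⟦ i ⟧ ∸ 1) ×
    (ν ⟦ suc iₐ ⟧ ≡ d ∸ 1) ×
    (∀ i → suc iₐ < i → ν ⟦ i ⟧ ≡ μ ⟦ i ∸ 1 ⟧)
lemma5p17 μ ν _ (m , m-hole , c , _ , ν≈) d iₐ dg li with maxHole-unique m-hole (diagonalHole μ dg li)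
... | refl = rows-above , row-inserted , rows-below
  where
  σ : ℕ → ℕ
  σ = insertRow iₐ d (μ ⟦_⟧)

  σ↓ : Decreasing σ
  σ↓ = insertRow-decreasing iₐ d (μ ⟦_⟧) (entry-decreasing (decr μ))
         (d≤row μ dg li (proj₁ li) ℕP.≤-refl) (row<d μ dg li ℕP.≤-refl)

  ν≡σ-c : ∀ t → 1 ≤ t → + ν ⟦ t ⟧ ≡ + σ t - c
  ν≡σ-c = seqMaya-translate⇒rows (entry-decreasing (decr ν)) σ↓
            (λ k → ⇔.trans (ν≈ k) (⇔.sym (insertRow-seqMaya iₐ d (μ ⟦_⟧) (k ℤ.+ c))))

  c≡1 : c ≡ + 1
  c≡1 = rows≡insertRow-c⇒c≡1 ν iₐ d (parts μ) {c} ν≡σ-c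

  ν≡σ∸1 : ∀ t → 1 ≤ t → ν ⟦ t ⟧ ≡ σ t ∸ 1
  ν≡σ∸1 t 1≤t = m≡n-1⇒m≡n∸1 (ν ⟦ t ⟧) (σ t) (trans (ν≡σ-c t 1≤t) (cong (+ σ t -_) c≡1))

  rows-above : ∀ i → 1 ≤ i → i ≤ iₐ → ν ⟦ i ⟧ ≡ μ ⟦ i ⟧ ∸ 1
  rows-above i 1≤i i≤iₐ = trans (ν≡σ∸1 i 1≤i) (cong (_∸ 1) (insertRow-< iₐ d (μ ⟦_⟧) (s≤s i≤iₐ)))

  row-inserted : ν ⟦ suc iₐ ⟧ ≡ d ∸ 1
  row-inserted = trans (ν≡σ∸1 (suc iₐ) (s≤s z≤n)) (cong (_∸ 1) (insertRow-≡ iₐ d (μ ⟦_⟧)))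

  rows-below : ∀ i → suc iₐ < i → ν ⟦ i ⟧ ≡ μ ⟦ i ∸ 1 ⟧
  rows-below i iₐ+1<i =
    trans (ν≡σ∸1 i (ℕP.≤-trans (s≤s z≤n) (ℕP.<⇒≤ iₐ+1<i))) (cong (_∸ 1) (insertRow-> iₐ d (μ ⟦_⟧) iₐ+1<i))
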